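{- Let $D$ be a digraph and let $\lambda$ be a lexicographic temporization of $D$ (with respect to any ordering of $V(D)$). Then every temporal path in $(D,\lambda)$ has length at most $2$.
   Context: $D$ is a finite simple digraph (no loops or parallel arcs) with $m$ arcs. Lexicographic temporization: fix an arbitrary linear order $<$ on $V(D)$ and order arcs $uv$ as ordered pairs $(u,v)$ lexicographically with respect to $<$. Let $m'$ be the number of arcs $uv$ with $u>v$. Assign to these arcs, one time each, the times $1,2,\dots,m'$ in increasing lexicographic order. Assign to the arcs $uv$ with $u<v$, one time each, the times $m'+1,\dots,m$ in reverse lexicographic order (the lexicographically largest such arc gets $m'+1$, the smallest gets $m$). Non-strict model: a temporal path is a sequence $(v_1,t_1,v_2,\dots,v_q,t_q,v_{q+1})$ with $v_iv_{i+1}\in A(D)$, $t_i\in\lambda(v_iv_{i+1})$, $t_1\le\dots\le t_q$, and distinct vertices (or $v_1=v_{q+1}$ with $v_1,\dots,v_q$ distinct); its length is $q$. -}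

module Defs where

open import Data.Nat using (ℕ; zero; suc; _+_; _≤_; _<ᵇ_; _≡ᵇ_; _≤ᵇ_)
open import Data.Bool using (Bool; true; false; _∧_; _∨_; if_then_else_)
open import Data.Fin using (Fin; inject₁; toℕ; fromℕ)
import Data.Fin as F
open import Data.List using (List; length; filter; map; concatMap)
open import Data.List using (allFin)
open import Data.Product using (_×_; _,_; proj₁; proj₂)
open import Data.Sum using (_⊎_)
open import Relation.Binary.PropositionalEquality using (_≡_)
open import Function.Definitions using (Injective)
open import Relation.Nullary.Decidable using (T?)

record Digraph : Set where
  field
    n        : ℕ
    adj      : Fin n → Fin n → Bool
    loopless : ∀ v → adj v v ≡ false
open Digraph public

-- An arbitrary linear order on V(D), given by an injective rank function:
-- u < v  iff  rank u < rank v.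
record LinOrder (D : Digraph) : Set where
  field
    rank    : Fin (n D) → ℕ
    rankInj : Injective _≡_ _≡_ rank
open LinOrder public

module _ (D : Digraph) (O : LinOrder D) where

  private
    r = rank O
    A = adj D

  pairs : List (Fin (n D) × Fin (n D))
  pairs = concatMap (λ x → map (λ y → (x , y)) (allFin (n D))) (allFin (n D))

  countP : (Fin (n D) × Fin (n D) → Bool) → ℕ
  countP p = length (filter (λ e → T? (p e)) pairs)

  lexLeᵇ : Fin (n D) × Fin (n D) → Fin (n D) × Fin (n D) → Bool
  lexLeᵇ (x , y) (u , v) = (r x <ᵇ r u) ∨ ((r x ≡ᵇ r u) ∧ (r y ≤ᵇ r v))

  backᵇ : Fin (n D) × Fin (n D) → Bool
  backᵇ (x , y) = A x y ∧ (r y <ᵇ r x)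

  fwdᵇ : Fin (n D) × Fin (n D) → Bool
  fwdᵇ (x , y) = A x y ∧ (r x <ᵇ r y)

  m′ : ℕ
  m′ = countP backᵇ

  -- The lexicographic temporization λ (each arc receives exactly one time):
  -- backward arcs get 1..m' in increasing lexicographic order,
  -- forward arcs get m'+1..m in reverse lexicographic order.
  lexTime : Fin (n D) → Fin (n D) → ℕ
  lexTime u v =
    if r v <ᵇ r u
    then countP (λ e → backᵇ e ∧ lexLeᵇ e (u , v))
    else m′ + countP (λ e → fwdᵇ e ∧ lexLeᵇ (u , v) e)

  -- A temporal path (non-strict model) of length q in (D, λ):
  -- vertices v_1..v_{q+1} given by vs, times t_1..t_q given by ts.
  record TemporalPath (q : ℕ) : Set where
    field
      vs     : Fin (suc q) → Fin (n D)
      ts     : Fin q → ℕ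
      isArc  : ∀ (i : Fin q) → A (vs (inject₁ i)) (vs (F.suc i)) ≡ true
      inλ    : ∀ (i : Fin q) → ts i ≡ lexTime (vs (inject₁ i)) (vs (F.suc i))
      nondec : ∀ (i j : Fin q) → toℕ j ≡ suc (toℕ i) → ts i ≤ ts j
      simple : Injective _≡_ _≡_ vs
             ⊎ (vs F.zero ≡ vs (fromℕ q) × Injective _≡_ _≡_ (λ (i : Fin q) → vs (inject₁ i)))

-- Backward arcs (u > v) receive the times 1..m′ and forward arcs the times
-- m′+1..m.  Two consecutive arcs xy, yz of a temporal path therefore cannot be
-- forward-then-backward; if both are backward then (y,z) precedes (x,y)
-- lexicographically because y < x, and if both are forward then (x,y) precedes
-- (y,z), which the reversed numbering turns into a decrease of time.  So every
-- interior vertex y of a temporal path is smaller than both of its neighbours,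
-- and two adjacent interior vertices would each be smaller than the other.
module Submission where

open import Defs
open import Data.Nat using (ℕ; zero; suc; _+_; _≤_; _<_; _<ᵇ_; z≤n; s≤s)
open import Data.Nat.Properties
open import Data.Bool using (Bool; true; false; T; _∧_)
open import Data.Bool.Properties using (T-≡; T-∧)
open import Data.Fin using (Fin; inject₁)
import Data.Fin as F
open import Data.Fin.Properties using (toℕ-inject₁)
open import Data.List using (List; []; _∷_; length; filter; map; allFin)
import Data.List.Relation.Unary.Any as Any
open import Data.List.Relation.Unary.Any using (here; there)
open import Data.List.Membership.Propositional using (_∈_)
open import Data.List.Membership.Propositional.Properties using (∈-allFin; ∈-map⁺; ∈-concatMap⁺)
open import Data.Product using (_×_; _,_; proj₁; proj₂)
open import Data.Empty using (⊥-elim)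
open import Function using (_∘′_)
open import Function.Bundles using (Equivalence)
open import Relation.Binary.PropositionalEquality using (_≡_; _≢_; refl; sym; cong; subst; subst₂)
open import Relation.Binary.Definitions using (tri<; tri≈; tri>)
open import Relation.Nullary using (¬_; contradiction)
open import Relation.Nullary.Decidable using (T?)

open Equivalence using (to; from)

module _ {A : Set} where

  count : (A → Bool) → List A → ℕ
  count p xs = length (filter (λ e → T? (p e)) xs)

  count-mono-≤ : (p q : A → Bool) → (∀ e → T (p e) → T (q e)) →
                 ∀ xs → count p xs ≤ count q xs
  count-mono-≤ p q p⇒q [] = z≤n
  count-mono-≤ p q p⇒q (x ∷ xs) with p x | q x | p⇒q x
  ... | false | false | _   = count-mono-≤ p q p⇒q xs
  ... | false | true  | _   = m≤n⇒m≤1+n (count-mono-≤ p q p⇒q xs)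
  ... | true  | false | p⇒q = ⊥-elim (p⇒q _)
  ... | true  | true  | _   = s≤s (count-mono-≤ p q p⇒q xs)

  count-mono-< : (p q : A → Bool) → (∀ e → T (p e) → T (q e)) →
                 ∀ {e} xs → e ∈ xs → T (q e) → ¬ T (p e) → count p xs < count q xs
  count-mono-< p q p⇒q (x ∷ xs) (here refl) qx ¬px with p x | q x
  ... | true  | _     = ⊥-elim (¬px _)
  ... | false | false = ⊥-elim qx
  ... | false | true  = s≤s (count-mono-≤ p q p⇒q xs)
  count-mono-< p q p⇒q (x ∷ xs) (there e∈xs) qe ¬pe with p x | q x | p⇒q x
  ... | false | false | _   = count-mono-< p q p⇒q xs e∈xs qe ¬pe
  ... | false | true  | _   = m≤n⇒m≤1+n (count-mono-< p q p⇒q xs e∈xs qe ¬pe)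
  ... | true  | false | p⇒q = ⊥-elim (p⇒q _)
  ... | true  | true  | _   = s≤s (count-mono-< p q p⇒q xs e∈xs qe ¬pe)

≥⇒<ᵇ≡false : ∀ {m n} → n ≤ m → (m <ᵇ n) ≡ false
≥⇒<ᵇ≡false {m} {n} n≤m with m <ᵇ n in eq
... | false = refl
... | true  = contradiction (<ᵇ⇒< m n (from T-≡ eq)) (≤⇒≯ n≤m)

module LexTemporization (D : Digraph) (O : LinOrder D) where

  private
    V = Fin (n D)
    r = rank O

  ∈-pairs : ∀ x y → (x , y) ∈ pairs D O
  ∈-pairs x y = ∈-concatMap⁺ (λ u → map (u ,_) (allFin (n D)))
    (Any.map (λ { refl → ∈-map⁺ (x ,_) (∈-allFin y) }) (∈-allFin x))

  arc⇒rank≢ : ∀ {x y} → T (adj D x y) → r x ≢ r y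
  arc⇒rank≢ {x} xy rx≡ry with rankInj O rx≡ry
  ... | refl = subst T (loopless D x) xy

  lexLe⇒rank≤ : ∀ a b c d → T (lexLeᵇ D O (a , b) (c , d)) → r a ≤ r c
  lexLe⇒rank≤ a b c d ab≤cd with r a <ᵇ r c in eq
  ... | true  = <⇒≤ (<ᵇ⇒< (r a) (r c) (from T-≡ eq))
  ... | false = ≤-reflexive (≡ᵇ⇒≡ (r a) (r c) (proj₁ (to T-∧ ab≤cd)))

  rank<⇒lexLe : ∀ a b c d → r a < r c → T (lexLeᵇ D O (a , b) (c , d))
  rank<⇒lexLe a b c d ra<rc rewrite to T-≡ (<⇒<ᵇ ra<rc) = _

  lexLe-refl : ∀ a b → T (lexLeᵇ D O (a , b) (a , b))
  lexLe-refl a b with r a <ᵇ r a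
  ... | true  = _
  ... | false = from T-∧ (≡⇒≡ᵇ (r a) (r a) refl , ≤⇒≤ᵇ (≤-refl {r b}))

  backwardUpTo : V × V → V × V → Bool
  backwardUpTo f e = backᵇ D O e ∧ lexLeᵇ D O e f

  forwardFrom : V × V → V × V → Bool
  forwardFrom f e = fwdᵇ D O e ∧ lexLeᵇ D O f e

  backwardUpTo-refl : ∀ x y → T (adj D x y) → r y < r x → T (backwardUpTo (x , y) (x , y))
  backwardUpTo-refl x y xy ry<rx = from T-∧ (from T-∧ (xy , <⇒<ᵇ ry<rx) , lexLe-refl x y)

  forwardFrom-refl : ∀ x y → T (adj D x y) → r x < r y → T (forwardFrom (x , y) (x , y))
  forwardFrom-refl x y xy rx<ry = from T-∧ (from T-∧ (xy , <⇒<ᵇ rx<ry) , lexLe-refl x y)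

  lexTime-backward : ∀ x y → r y < r x →
                     lexTime D O x y ≡ countP D O (backwardUpTo (x , y))
  lexTime-backward x y ry<rx rewrite to T-≡ (<⇒<ᵇ ry<rx) = refl

  lexTime-forward : ∀ x y → r x < r y →
                    lexTime D O x y ≡ m′ D O + countP D O (forwardFrom (x , y))
  lexTime-forward x y rx<ry rewrite ≥⇒<ᵇ≡false (<⇒≤ rx<ry) = refl

  lexTime-backward≤m′ : ∀ x y → r y < r x → lexTime D O x y ≤ m′ D O
  lexTime-backward≤m′ x y ry<rx rewrite lexTime-backward x y ry<rx =
    count-mono-≤ (backwardUpTo (x , y)) (backᵇ D O) (λ _ → proj₁ ∘′ to T-∧) (pairs D O)

  m′<lexTime-forward : ∀ x y → T (adj D x y) → r x < r y → m′ D O < lexTime D O x y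
  m′<lexTime-forward x y xy rx<ry rewrite lexTime-forward x y rx<ry =
    m<m+n (m′ D O) (≤-<-trans z≤n
      (count-mono-< (λ _ → false) (forwardFrom (x , y)) (λ _ ())
        (pairs D O) (∈-pairs x y) (forwardFrom-refl x y xy rx<ry) (λ ())))

  lexTime-backward-mono : ∀ a b c d → r b < r a → T (adj D c d) → r d < r c → r a < r c →
                          lexTime D O a b < lexTime D O c d
  lexTime-backward-mono a b c d rb<ra cd rd<rc ra<rc
    rewrite lexTime-backward a b rb<ra | lexTime-backward c d rd<rc =
    count-mono-< (backwardUpTo (a , b)) (backwardUpTo (c , d)) upTo-ab⇒upTo-cd (pairs D O)
      (∈-pairs c d) (backwardUpTo-refl c d cd rd<rc)
      (λ h → <⇒≱ ra<rc (lexLe⇒rank≤ c d a b (proj₂ (to T-∧ h))))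
    where
    upTo-ab⇒upTo-cd : ∀ e → T (backwardUpTo (a , b) e) → T (backwardUpTo (c , d) e)
    upTo-ab⇒upTo-cd (u , v) h with to T-∧ h
    ... | uv , uv≤ab = from T-∧ (uv , rank<⇒lexLe u v c d (≤-<-trans (lexLe⇒rank≤ u v a b uv≤ab) ra<rc))

  lexTime-forward-antitone : ∀ a b c d → T (adj D a b) → r a < r b → r c < r d → r a < r c →
                             lexTime D O c d < lexTime D O a b
  lexTime-forward-antitone a b c d ab ra<rb rc<rd ra<rc
    rewrite lexTime-forward a b ra<rb | lexTime-forward c d rc<rd =
    +-monoʳ-< (m′ D O) (count-mono-< (forwardFrom (c , d)) (forwardFrom (a , b)) from-cd⇒from-ab
      (pairs D O)
      (∈-pairs a b) (forwardFrom-refl a b ab ra<rb)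
      (λ h → <⇒≱ ra<rc (lexLe⇒rank≤ c d a b (proj₂ (to T-∧ h)))))
    where
    from-cd⇒from-ab : ∀ e → T (forwardFrom (c , d) e) → T (forwardFrom (a , b) e)
    from-cd⇒from-ab (u , v) h with to T-∧ h
    ... | uv , cd≤uv = from T-∧ (uv , rank<⇒lexLe a b u v (<-≤-trans ra<rc (lexLe⇒rank≤ c d u v cd≤uv)))

  nondecreasing-step⇒valley : ∀ x y z → T (adj D x y) → T (adj D y z) →
                              lexTime D O x y ≤ lexTime D O y z → r y < r x × r y < r z
  nondecreasing-step⇒valley x y z xy yz t≤t′ with <-cmp (r y) (r x) | <-cmp (r z) (r y)
  ... | tri≈ _ ry≡rx _ | _ = contradiction (sym ry≡rx) (arc⇒rank≢ xy)
  ... | _ | tri≈ _ rz≡ry _ = contradiction (sym rz≡ry) (arc⇒rank≢ yz)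
  ... | tri< ry<rx _ _ | tri> _ _ ry<rz = ry<rx , ry<rz
  ... | tri< ry<rx _ _ | tri< rz<ry _ _ =
    contradiction t≤t′ (<⇒≱ (lexTime-backward-mono y z x y rz<ry xy ry<rx ry<rx))
  ... | tri> _ _ rx<ry | tri> _ _ ry<rz =
    contradiction t≤t′ (<⇒≱ (lexTime-forward-antitone x y y z xy rx<ry ry<rz rx<ry))
  ... | tri> _ _ rx<ry | tri< rz<ry _ _ =
    contradiction t≤t′ (<⇒≱ (≤-<-trans (lexTime-backward≤m′ y z rz<ry) (m′<lexTime-forward x y xy rx<ry)))

  interior-vertex-is-valley : ∀ {q} (P : TemporalPath D O (suc q)) (i : Fin q) →
    let open TemporalPath P in
    r (vs (F.suc (inject₁ i))) < r (vs (inject₁ (inject₁ i))) ×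
    r (vs (F.suc (inject₁ i))) < r (vs (F.suc (F.suc i)))
  interior-vertex-is-valley P i =
    nondecreasing-step⇒valley _ _ _ (arc (inject₁ i)) (arc (F.suc i))
      (subst₂ _≤_ (inλ (inject₁ i)) (inλ (F.suc i))
        (nondec (inject₁ i) (F.suc i) (cong suc (sym (toℕ-inject₁ i)))))
    where
    open TemporalPath P
    arc : ∀ j → T (adj D (vs (inject₁ j)) (vs (F.suc j)))
    arc j = from T-≡ (isArc j)

lemma2 : (D : Digraph) (O : LinOrder D) (q : ℕ) → TemporalPath D O q → q ≤ 2
lemma2 D O zero             P = z≤n
lemma2 D O (suc zero)       P = s≤s z≤n
lemma2 D O (suc (suc zero)) P = s≤s (s≤s z≤n)
lemma2 D O (suc (suc (suc q))) P =
  contradiction (proj₂ (interior-vertex-is-valley P F.zero))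
                (<-asym (proj₁ (interior-vertex-is-valley P (F.suc F.zero))))
  where open LexTemporization D O
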